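{- For every cycle $C$ on at least $4$ vertices, $4\le \pi_T(C)\le 6$.
   Context: A sequence is nonrepetitive if it contains no block of consecutive terms $r_1\dots r_{2n}$ ($n\ge1$) with $r_i=r_{n+i}$ for all $i$. For a graph $G$, a (strong) total Thue colouring is a colouring $\varphi$ of $V(G)\cup E(G)$ such that for every path $v_0e_1v_1\dots e_kv_k$ in $G$ the three sequences $\varphi(v_0)\varphi(e_1)\varphi(v_1)\dots\varphi(e_k)\varphi(v_k)$, $\varphi(v_0)\varphi(v_1)\dots\varphi(v_k)$ and $\varphi(e_1)\dots\varphi(e_k)$ are all nonrepetitive. $\pi_T(G)$ is the minimum number of colours in a total Thue colouring of $G$. -}

module Defs where

open import Data.Nat using (ℕ; zero; suc; _≤_)
open import Data.Fin using (Fin; toℕ)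
open import Data.List using (List; []; _∷_; _++_; map)
open import Data.List.Relation.Unary.Unique.Propositional using (Unique)
open import Data.List.Relation.Unary.Linked using (Linked)
open import Data.Product using (Σ; _×_; ∃-syntax)
open import Data.Sum using (_⊎_)
open import Relation.Binary.PropositionalEquality using (_≡_; _≢_)
open import Relation.Nullary using (¬_)
import Data.Empty

Nonrepetitive : {A : Set} → List A → Set
Nonrepetitive {A} l =
  ¬ (∃[ xs ] ∃[ ys ] ∃[ zs ] (ys ≢ [] × l ≡ xs ++ (ys ++ (ys ++ zs))))

record Graph : Set₁ where
  field
    size  : ℕ
    Adj   : Fin size → Fin size → Set
    adjSym : ∀ {u v} → Adj u v → Adj v u
    adjIrrefl : ∀ {u} → ¬ Adj u u

open Graph public

IsPath : (G : Graph) → List (Fin (size G)) → Set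
IsPath G vs = Unique vs × Linked (Adj G) vs

record TotalColouring (G : Graph) (C : Set) : Set where
  field
    vertexCol : Fin (size G) → C
    edgeCol   : Fin (size G) → Fin (size G) → C
    edgeSym   : ∀ u v → Adj G u v → edgeCol u v ≡ edgeCol v u

open TotalColouring public

module _ {G : Graph} {C : Set} (φ : TotalColouring G C) where
  vertexSeq : List (Fin (size G)) → List C
  vertexSeq = map (vertexCol φ)

  edgeSeq : List (Fin (size G)) → List C
  edgeSeq (u ∷ v ∷ rest) = edgeCol φ u v ∷ edgeSeq (v ∷ rest)
  edgeSeq _ = []

  totalSeq : List (Fin (size G)) → List C
  totalSeq [] = []
  totalSeq (u ∷ []) = vertexCol φ u ∷ []
  totalSeq (u ∷ v ∷ rest) = vertexCol φ u ∷ edgeCol φ u v ∷ totalSeq (v ∷ rest)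

IsTotalThue : {G : Graph} {C : Set} → TotalColouring G C → Set
IsTotalThue {G} φ = ∀ vs → IsPath G vs →
  Nonrepetitive (totalSeq φ vs) × Nonrepetitive (vertexSeq φ vs) × Nonrepetitive (edgeSeq φ vs)

HasTotalThue : Graph → ℕ → Set
HasTotalThue G m = Σ (TotalColouring G (Fin m)) IsTotalThue

CycleStep : (n : ℕ) → Fin n → Fin n → Set
CycleStep n i j = (toℕ j ≡ suc (toℕ i)) ⊎ (suc (toℕ i) ≡ n × toℕ j ≡ 0)

CycleAdj : (n : ℕ) → Fin n → Fin n → Set
CycleAdj n i j = CycleStep n i j ⊎ CycleStep n j i

open import Data.Sum using (inj₁; inj₂)
open import Data.Product using (_,_)
open import Data.Nat.Properties using (1+n≢n)
open import Relation.Binary.PropositionalEquality using (refl; sym)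

private
  nat-lemma : ∀ {n k} → 3 ≤ n → suc k ≡ n → k ≡ 0 → Data.Empty.⊥
  nat-lemma h refl refl with h
  ... | Data.Nat.s≤s ()

  step-irrefl : ∀ {n} → 3 ≤ n → {i : Fin n} → ¬ CycleStep n i i
  step-irrefl _ (inj₁ e) = 1+n≢n (sym e)
  step-irrefl h (inj₂ (e , z)) = nat-lemma h e z

Cycle : (n : ℕ) → 3 ≤ n → Graph
Cycle n h = record
  { size = n
  ; Adj = CycleAdj n
  ; adjSym = λ { (inj₁ s) → inj₂ s ; (inj₂ s) → inj₁ s }
  ; adjIrrefl = λ { (inj₁ s) → step-irrefl h s ; (inj₂ s) → step-irrefl h s }
  }

-- Three colours fail already on a path with four vertices: consecutive entries of the total
-- sequence differ, and so do entries two apart (they are both vertices or both edges), so over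
-- three colours the seven entries have period three and form the square abc·abc·a.
--
-- For six colours, Thue's overlap-free Thue–Morse word t gives the square-free ternary word
-- x i = code (t i) (t (i + 1)). On a cycle of order n the vertices 0 … n-2 get lo (x i), the edges
-- leaving them hi (x i), and the last vertex and edge get marker colours. A path winds around the
-- cycle in one direction and has at most n vertices, so its vertex and edge sequences are windows of
-- these n-periodic colourings: a short square in one either avoids the marker, contradicting
-- square-freeness of x, or forces two markers less than n apart. In the total sequence, squares of
-- even period restrict to the vertices, and squares of odd period match vertex colours with edge
-- colours, which come from the disjoint palettes lo and hi except at the markers.

module Submission where

open import Defs
open import Data.Nat using (ℕ; zero; suc; _+_; _∸_; _≤_; _<_; z≤n; s≤s; s≤s⁻¹; _≟_; _<?_; _≤?_; NonZero)
open import Data.Nat.Properties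
open import Data.Nat.DivMod using (_%_; m%n<n; m<n⇒m%n≡m; %-distribˡ-+; [m+n]%n≡m%n; n%n≡0)
open import Data.Nat.Induction using (<-rec)
open import Data.Nat.Tactic.RingSolver using (solve-∀)
open import Data.Bool using (Bool; true; false; not)
import Data.Bool as Bool
open import Data.Bool.Properties using (not-¬; ¬-not; not-injective)
open import Data.Fin using (Fin; zero; suc; toℕ; fromℕ<; punchOut; _↑ˡ_; _↑ʳ_)
import Data.Fin as Fin
open import Data.Fin.Properties
  using (toℕ-fromℕ<; toℕ-injective; toℕ<n; punchOut-injective; toℕ-↑ˡ; toℕ-↑ʳ; ↑ˡ-injective; ↑ʳ-injective)
open import Data.List using (List; []; _∷_; _++_; length; reverse; _∷ʳ_)
open import Data.List.Properties
  using ( length-++; reverse-++; reverse-involutive; reverse-map; unfold-reverse; ++-assoc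
        ; ∷-injective; ∷-injectiveˡ; ∷-injectiveʳ)
open import Data.List.Membership.Propositional using (_∈_)
open import Data.List.Relation.Unary.All using ([]; _∷_)
open import Data.List.Relation.Unary.All.Properties using (All¬⇒¬Any)
open import Data.List.Relation.Unary.Any using (here; there)
import Data.List.Relation.Unary.Any.Properties as Any
open import Data.List.Relation.Unary.AllPairs using ([]; _∷_)
open import Data.List.Relation.Unary.Linked using (Linked; []; [-]; _∷_)
open import Data.List.Relation.Unary.Unique.Propositional using (Unique)
open import Data.Product using (_×_; _,_; proj₁; ∃-syntax)
open import Data.Sum using (_⊎_; inj₁; inj₂)
open import Data.Empty using (⊥)
open import Function using (_∘_; _∘′_)
open import Relation.Binary.PropositionalEquality
open import Relation.Nullary using (¬_; yes; no; contradiction)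

+-right-comm : ∀ a b c → a + b + c ≡ a + c + b
+-right-comm = solve-∀

double-suc : ∀ n → suc (suc (n + n)) ≡ suc n + suc n
double-suc n = cong suc (sym (+-suc n n))

m+m≤1+n⇒m≤n : ∀ m n → m + m ≤ suc n → m ≤ n
m+m≤1+n⇒m≤n zero n _ = z≤n
m+m≤1+n⇒m≤n (suc m) n (s≤s le) = ≤-trans (m≤n+m (suc m) m) le

m+m≤1+n+n⇒m≤n : ∀ m n → m + m ≤ suc (n + n) → m ≤ n
m+m≤1+n+n⇒m≤n m n le =
  ≮⇒≥ λ n<m → 1+n≰n (≤-trans (subst (_≤ m + m) (sym (double-suc n)) (+-mono-≤ n<m n<m)) le)

SquareAt : {A : Set} → (ℕ → A) → ℕ → ℕ → Set
SquareAt F p m = ∀ j → j < m → F (p + j) ≡ F (p + m + j)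

ShortSquareFree : {A : Set} → (ℕ → A) → ℕ → Set
ShortSquareFree F L = ∀ p m → 1 ≤ m → m + m ≤ L → ¬ SquareAt F p m

shortSquareFree-≤ : {A : Set} {F : ℕ → A} {L L′ : ℕ} → L ≤ L′ → ShortSquareFree F L′ → ShortSquareFree F L
shortSquareFree-≤ L≤L′ ssf p m 1≤m 2m≤L = ssf p m 1≤m (≤-trans 2m≤L L≤L′)

shortSquareFree-≗ : {A : Set} {F G : ℕ → A} {L : ℕ} →
                    (∀ i → F i ≡ G i) → ShortSquareFree G L → ShortSquareFree F L
shortSquareFree-≗ F≗G ssf p m 1≤m 2m≤L sq =
  ssf p m 1≤m 2m≤L (λ j j<m → trans (sym (F≗G (p + j))) (trans (sq j j<m) (F≗G (p + m + j))))

window : {A : Set} → (ℕ → A) → ℕ → ℕ → List A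
window F s zero = []
window F s (suc L) = F s ∷ window F (suc s) L

module _ {A : Set} (F : ℕ → A) where

  length-window : ∀ s L → length (window F s L) ≡ L
  length-window s zero = refl
  length-window s (suc L) = cong suc (length-window (suc s) L)

  window-snoc : ∀ s L → window F s (suc L) ≡ window F s L ∷ʳ F (s + L)
  window-snoc s zero = cong (λ t → F t ∷ []) (sym (+-identityʳ s))
  window-snoc s (suc L) =
    cong (F s ∷_) (trans (window-snoc (suc s) L) (cong (λ t → window F (suc s) L ∷ʳ F t) (sym (+-suc s L))))

  reverse-window-suc : ∀ s L → reverse (window F s (suc L)) ≡ F (s + L) ∷ reverse (window F s L)
  reverse-window-suc s L = trans (cong reverse (window-snoc s L)) (reverse-++ (window F s L) (F (s + L) ∷ []))

  ∈-window : ∀ s L j → j < L → F (s + j) ∈ window F s L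
  ∈-window s (suc L) zero _ = here (cong F (+-identityʳ s))
  ∈-window s (suc L) (suc j) (s≤s j<L) =
    there (subst (_∈ window F (suc s) L) (cong F (sym (+-suc s j))) (∈-window (suc s) L j j<L))

  window-split : ∀ xs {ys} s L → xs ++ ys ≡ window F s L →
                 xs ≡ window F s (length xs) × ys ≡ window F (s + length xs) (L ∸ length xs)
  window-split [] s L eq = refl , trans eq (cong (λ t → window F t L) (sym (+-identityʳ s)))
  window-split (x ∷ xs) s (suc L) eq
    with refl , eq′ ← ∷-injective eq
    with xs≡ , ys≡ ← window-split xs (suc s) L eq′ =
    cong (F s ∷_) xs≡ , trans ys≡ (cong (λ t → window F t (L ∸ length xs)) (sym (+-suc s (length xs))))

  window-≡⇒≡ : ∀ p q m → window F p m ≡ window F q m → ∀ j → j < m → F (p + j) ≡ F (q + j)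
  window-≡⇒≡ p q (suc m) eq zero _ =
    trans (cong F (+-identityʳ p)) (trans (∷-injectiveˡ eq) (cong F (sym (+-identityʳ q))))
  window-≡⇒≡ p q (suc m) eq (suc j) (s≤s j<m) =
    trans (cong F (+-suc p j)) (trans (window-≡⇒≡ (suc p) (suc q) m (∷-injectiveʳ eq) j j<m) (cong F (sym (+-suc q j))))

  nonrepetitive-window : ∀ L → ShortSquareFree F L → ∀ s → Nonrepetitive (window F s L)
  nonrepetitive-window L ssf s (xs , ys@(_ ∷ _) , zs , _ , eq)
    with _ , rest₁ ← window-split xs s L (sym eq)
    with ys≡₁ , rest₂ ← window-split ys (s + length xs) _ rest₁
    with ys≡₂ , _ ← window-split ys (s + length xs + length ys) _ rest₂ =
    ssf (s + length xs) m (s≤s z≤n) m+m≤L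
        (window-≡⇒≡ (s + length xs) (s + length xs + m) m (trans (sym ys≡₁) ys≡₂))
    where
    m : ℕ
    m = length ys
    m+m≤L : m + m ≤ L
    m+m≤L = begin
      m + m                               ≤⟨ +-monoʳ-≤ m (m≤m+n m (length zs)) ⟩
      m + (m + length zs)                 ≤⟨ m≤n+m _ (length xs) ⟩
      length xs + (m + (m + length zs))   ≡⟨ cong (λ t → length xs + (m + t)) (length-++ ys) ⟨
      length xs + (m + length (ys ++ zs)) ≡⟨ cong (length xs +_) (length-++ ys) ⟨
      length xs + length (ys ++ ys ++ zs) ≡⟨ length-++ xs ⟨
      length (xs ++ ys ++ ys ++ zs)       ≡⟨ cong length eq ⟨
      length (window F s L)               ≡⟨ length-window s L ⟩
      L                                   ∎
      where open ≤-Reasoning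
  nonrepetitive-window L ssf s (xs , [] , zs , ys≢[] , eq) = ys≢[] refl

nonrepetitive-[] : {A : Set} → Nonrepetitive {A} []
nonrepetitive-[] ([] , [] , _ , ys≢[] , _) = ys≢[] refl

nonrepetitive-reverse : {A : Set} (l : List A) → Nonrepetitive l → Nonrepetitive (reverse l)
nonrepetitive-reverse l nr (xs , ys , zs , ys≢[] , eq) =
  nr (reverse zs , reverse ys , reverse xs , reverse-ys≢[] , l≡)
  where
  reverse-ys≢[] : reverse ys ≢ []
  reverse-ys≢[] e = ys≢[] (trans (sym (reverse-involutive ys)) (cong reverse e))
  l≡ : l ≡ reverse zs ++ (reverse ys ++ (reverse ys ++ reverse xs))
  l≡ = begin
    l                                              ≡⟨ sym (reverse-involutive l) ⟩
    reverse (reverse l)                            ≡⟨ cong reverse eq ⟩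
    reverse (xs ++ (ys ++ (ys ++ zs)))             ≡⟨ reverse-++ xs _ ⟩
    reverse (ys ++ (ys ++ zs)) ++ reverse xs       ≡⟨ cong (_++ reverse xs) (reverse-++ ys _) ⟩
    (reverse (ys ++ zs) ++ reverse ys) ++ reverse xs ≡⟨ cong (λ t → (t ++ reverse ys) ++ reverse xs) (reverse-++ ys zs) ⟩
    ((reverse zs ++ reverse ys) ++ reverse ys) ++ reverse xs ≡⟨ ++-assoc (reverse zs ++ reverse ys) _ _ ⟩
    (reverse zs ++ reverse ys) ++ (reverse ys ++ reverse xs) ≡⟨ ++-assoc (reverse zs) _ _ ⟩
    reverse zs ++ (reverse ys ++ (reverse ys ++ reverse xs)) ∎
    where open ≡-Reasoning

-- The Thue–Morse word and a square-free ternary word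

halve : ℕ → ℕ × Bool
halve zero = zero , false
halve (suc n) with halve n
... | k , false = k , true
... | k , true = suc k , false

halve-even : ∀ k → halve (k + k) ≡ (k , false)
halve-odd : ∀ k → halve (suc (k + k)) ≡ (k , true)
halve-even zero = refl
halve-even (suc k) rewrite +-suc k k | halve-odd k = refl
halve-odd k rewrite halve-even k = refl

parity : ∀ n → ∃[ k ] (n ≡ k + k ⊎ n ≡ suc (k + k))
parity zero = zero , inj₁ refl
parity (suc n) with parity n
... | k , inj₁ refl = k , inj₂ refl
... | k , inj₂ refl = suc k , inj₁ (cong suc (sym (+-suc k k)))

-- With fuel f ≥ n, bitParity f n is the parity of the binary digit sum of n.
bitParity : ℕ → ℕ → Bool
bitParity zero n = false
bitParity (suc f) n with halve n
... | k , false = bitParity f k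
... | k , true = not (bitParity f k)

bitParity-zero : ∀ f → bitParity f 0 ≡ false
bitParity-zero zero = refl
bitParity-zero (suc f) = bitParity-zero f

bitParity-fuel : ∀ f g n → n ≤ f → n ≤ g → bitParity f n ≡ bitParity g n
bitParity-fuel zero g .zero z≤n _ = sym (bitParity-zero g)
bitParity-fuel (suc f) zero .zero _ z≤n = bitParity-zero (suc f)
bitParity-fuel (suc f) (suc g) n n≤f n≤g with parity n
... | k , inj₁ refl rewrite halve-even k =
  bitParity-fuel f g k (m+m≤1+n⇒m≤n k f n≤f) (m+m≤1+n⇒m≤n k g n≤g)
... | k , inj₂ refl rewrite halve-odd k =
  cong not (bitParity-fuel f g k (≤-trans (m≤m+n k k) (s≤s⁻¹ n≤f)) (≤-trans (m≤m+n k k) (s≤s⁻¹ n≤g)))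

thueMorse : ℕ → Bool
thueMorse n = bitParity n n

thueMorse-double : ∀ k → thueMorse (k + k) ≡ thueMorse k
thueMorse-double zero = refl
thueMorse-double (suc k) rewrite halve-even (suc k) =
  bitParity-fuel (k + suc k) (suc k) (suc k) (m≤n+m (suc k) k) ≤-refl

thueMorse-double+1 : ∀ k → thueMorse (suc (k + k)) ≡ not (thueMorse k)
thueMorse-double+1 k rewrite halve-odd k = cong not (bitParity-fuel (k + k) k k (m≤m+n k k) ≤-refl)

thueMorse-at-double : ∀ {n} k → n ≡ k + k → thueMorse n ≡ thueMorse k
thueMorse-at-double k refl = thueMorse-double k

thueMorse-at-double+1 : ∀ {n} k → n ≡ suc (k + k) → thueMorse n ≡ not (thueMorse k)
thueMorse-at-double+1 k refl = thueMorse-double+1 k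

Changes : ℕ → Set
Changes n = thueMorse n ≢ thueMorse (suc n)

changes-double : ∀ k → Changes (k + k)
changes-double k eq = not-¬ refl (begin
  thueMorse k              ≡⟨ sym (thueMorse-double k) ⟩
  thueMorse (k + k)        ≡⟨ eq ⟩
  thueMorse (suc (k + k))  ≡⟨ thueMorse-double+1 k ⟩
  not (thueMorse k)        ∎)
  where open ≡-Reasoning

thueMorse-no-triple : ∀ n → thueMorse n ≡ thueMorse (suc n) → thueMorse (suc n) ≡ thueMorse (suc (suc n)) → ⊥
thueMorse-no-triple n e₁ e₂ with parity n
... | k , inj₁ refl = changes-double k e₁
... | k , inj₂ refl = changes-double (suc k) (subst (λ t → thueMorse t ≡ thueMorse (suc t)) (double-suc k) e₂)

changes-twice : ∀ n → Changes n → Changes (suc n) → thueMorse n ≡ thueMorse (suc (suc n))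
changes-twice n c₁ c₂ = trans (¬-not c₁) (sym (¬-not (c₂ ∘ sym)))

thueMorse-no-changes-run : ∀ a → Changes (suc (a + a)) → Changes (suc (suc (a + a))) →
                           Changes (suc (suc (suc (a + a)))) → ⊥
thueMorse-no-changes-run a c₁ c₂ c₃ = thueMorse-no-triple a e₁ e₂
  where
  open ≡-Reasoning
  e₁ : thueMorse a ≡ thueMorse (suc a)
  e₁ = not-injective (begin
    not (thueMorse a)                    ≡⟨ sym (thueMorse-double+1 a) ⟩
    thueMorse (suc (a + a))              ≡⟨ changes-twice (suc (a + a)) c₁ c₂ ⟩
    thueMorse (suc (suc (suc (a + a))))  ≡⟨ thueMorse-at-double+1 (suc a) (cong suc (double-suc a)) ⟩
    not (thueMorse (suc a))              ∎)
  e₂ : thueMorse (suc a) ≡ thueMorse (suc (suc a))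
  e₂ = begin
    thueMorse (suc a)                          ≡⟨ sym (thueMorse-at-double (suc a) (double-suc a)) ⟩
    thueMorse (suc (suc (a + a)))              ≡⟨ changes-twice (suc (suc (a + a))) c₂ c₃ ⟩
    thueMorse (suc (suc (suc (suc (a + a)))))
      ≡⟨ thueMorse-at-double (suc (suc a)) (trans (cong (λ n → suc (suc n)) (double-suc a)) (double-suc (suc a))) ⟩
    thueMorse (suc (suc a))                    ∎

Overlap : ℕ → ℕ → Set
Overlap i m = ∀ j → j ≤ m → thueMorse (i + j) ≡ thueMorse (i + m + j)

module _ {i m} (ov : Overlap i m) {j} (j<m : j < m) where

  private
    same-next : thueMorse (suc (i + j)) ≡ thueMorse (suc (i + m + j))
    same-next = begin
      thueMorse (suc (i + j))      ≡⟨ cong thueMorse (sym (+-suc i j)) ⟩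
      thueMorse (i + suc j)        ≡⟨ ov (suc j) j<m ⟩
      thueMorse (i + m + suc j)    ≡⟨ cong thueMorse (+-suc (i + m) j) ⟩
      thueMorse (suc (i + m + j))  ∎
      where open ≡-Reasoning

  overlap-changesʳ : Changes (i + j) → Changes (i + m + j)
  overlap-changesʳ c e = c (trans (ov j (<⇒≤ j<m)) (trans e (sym same-next)))

  overlap-changesˡ : Changes (i + m + j) → Changes (i + j)
  overlap-changesˡ c e = c (trans (sym (ov j (<⇒≤ j<m))) (trans e same-next))

-- In an overlap of odd period an odd position is paired with an even one, which changes.
overlap-odd-changes-left : ∀ i k → Overlap i (suc (k + k)) → ∀ j → j < suc (k + k) → Changes (i + j)
overlap-odd-changes-left i k ov j j<m with parity (i + j)
... | c , inj₁ e = subst Changes (sym e) (changes-double c)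
... | c , inj₂ e = overlap-changesˡ {i} {suc (k + k)} ov j<m (subst Changes (sym partner-even) (changes-double (c + suc k)))
  where
  pair : ∀ c k → suc (c + c) + suc (k + k) ≡ (c + suc k) + (c + suc k)
  pair = solve-∀
  partner-even : i + suc (k + k) + j ≡ (c + suc k) + (c + suc k)
  partner-even = trans (+-right-comm i (suc (k + k)) j) (trans (cong (_+ suc (k + k)) e) (pair c k))

overlap-odd-changes : ∀ i k → Overlap i (suc (k + k)) → ∀ j → j < suc (k + k) + suc (k + k) → Changes (i + j)
overlap-odd-changes i k ov j j<2m with j <? suc (k + k)
... | yes j<m = overlap-odd-changes-left i k ov j j<m
... | no j≮m = subst Changes i+m+j′≡i+j (overlap-changesʳ {i} {m} ov j′<m (overlap-odd-changes-left i k ov j′ j′<m))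
  where
  m j′ : ℕ
  m = suc (k + k)
  j′ = j ∸ m
  m+j′≡j : m + j′ ≡ j
  m+j′≡j = m+[n∸m]≡n (≮⇒≥ j≮m)
  j′<m : j′ < m
  j′<m = +-cancelˡ-< m j′ m (subst (_< m + m) (sym m+j′≡j) j<2m)
  i+m+j′≡i+j : i + m + j′ ≡ i + j
  i+m+j′≡i+j = trans (+-assoc i m j′) (cong (i +_) m+j′≡j)

overlap-halve : ∀ i i′ k → (i ≡ i′ + i′ ⊎ i ≡ suc (i′ + i′)) → Overlap i (k + k) → Overlap i′ k
overlap-halve _ i′ k (inj₁ refl) ov j j≤k = begin
  thueMorse (i′ + j)                       ≡⟨ sym (thueMorse-at-double (i′ + j) (start i′ j)) ⟩
  thueMorse (i′ + i′ + (j + j))            ≡⟨ ov (j + j) (+-mono-≤ j≤k j≤k) ⟩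
  thueMorse (i′ + i′ + (k + k) + (j + j))  ≡⟨ thueMorse-at-double (i′ + k + j) (end i′ k j) ⟩
  thueMorse (i′ + k + j)                   ∎
  where
  open ≡-Reasoning
  start : ∀ a j → a + a + (j + j) ≡ (a + j) + (a + j)
  start = solve-∀
  end : ∀ a k j → a + a + (k + k) + (j + j) ≡ (a + k + j) + (a + k + j)
  end = solve-∀
overlap-halve _ i′ k (inj₂ refl) ov j j≤k = not-injective (begin
  not (thueMorse (i′ + j))                       ≡⟨ sym (thueMorse-at-double+1 (i′ + j) (start i′ j)) ⟩
  thueMorse (suc (i′ + i′) + (j + j))            ≡⟨ ov (j + j) (+-mono-≤ j≤k j≤k) ⟩
  thueMorse (suc (i′ + i′) + (k + k) + (j + j))  ≡⟨ thueMorse-at-double+1 (i′ + k + j) (end i′ k j) ⟩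
  not (thueMorse (i′ + k + j))                   ∎)
  where
  open ≡-Reasoning
  start : ∀ a j → suc (a + a) + (j + j) ≡ suc ((a + j) + (a + j))
  start = solve-∀
  end : ∀ a k j → suc (a + a) + (k + k) + (j + j) ≡ suc ((a + k + j) + (a + k + j))
  end = solve-∀

changes-near-start : ∀ i k → Overlap i (suc (suc k + suc k)) → ∀ j → j ≤ 3 → Changes (j + i)
changes-near-start i k ov j j≤3 =
  subst Changes (+-comm i j) (overlap-odd-changes i (suc k) ov j (≤-trans (s≤s j≤3) 4≤m+m))
  where
  m : ℕ
  m = suc (suc k + suc k)
  3≤m : 3 ≤ m
  3≤m = s≤s (s≤s (≤-trans (s≤s z≤n) (m≤n+m (suc k) k)))
  4≤m+m : 4 ≤ m + m
  4≤m+m = ≤-trans (s≤s (s≤s (s≤s (s≤s z≤n)))) (+-mono-≤ 3≤m 3≤m)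

-- Thue's argument: an overlap of period m ≥ 1 halves to a shorter one when m is even, and forces
-- three consecutive changes from an odd position when m is odd.
thueMorse-overlapFree : ∀ m i → 1 ≤ m → ¬ Overlap i m
thueMorse-overlapFree = <-rec (λ m → ∀ i → 1 ≤ m → ¬ Overlap i m) step
  where
  step : ∀ m → (∀ {m′} → m′ < m → ∀ i → 1 ≤ m′ → ¬ Overlap i m′) → ∀ i → 1 ≤ m → ¬ Overlap i m
  step m rec i 1≤m ov with parity m
  ... | zero , inj₁ refl = contradiction 1≤m λ ()
  ... | suc k , inj₁ refl with parity i
  ...   | i′ , i≡ = rec (m<m+n (suc k) (s≤s z≤n)) i′ (s≤s z≤n) (overlap-halve i i′ (suc k) i≡ ov)
  step m rec i 1≤m ov | zero , inj₂ refl =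
    overlap-odd-changes i 0 ov 0 (s≤s z≤n) (trans (ov 0 z≤n) (cong thueMorse (next i)))
    where
    next : ∀ i → i + 1 + 0 ≡ suc (i + 0)
    next = solve-∀
  step m rec i 1≤m ov | suc k , inj₂ refl with parity i
  ... | a , inj₁ refl = thueMorse-no-changes-run a (near 1 (s≤s z≤n)) (near 2 (s≤s (s≤s z≤n))) (near 3 ≤-refl)
    where
    near : ∀ j → j ≤ 3 → Changes (j + (a + a))
    near = changes-near-start (a + a) k ov
  ... | a , inj₂ refl = thueMorse-no-changes-run a (near 0 z≤n) (near 1 (s≤s z≤n)) (near 2 (s≤s (s≤s z≤n)))
    where
    near : ∀ j → j ≤ 3 → Changes (j + suc (a + a))
    near = changes-near-start (suc (a + a)) k ov

code : Bool → Bool → Fin 3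
code false false = suc zero
code true  true  = suc zero
code false true  = suc (suc zero)
code true  false = zero

code-≡ : ∀ a b c d → code a b ≡ code c d → (a ≡ b × c ≡ d) ⊎ (a ≡ c × b ≡ d)
code-≡ false false false false _ = inj₁ (refl , refl)
code-≡ false false true  true  _ = inj₁ (refl , refl)
code-≡ true  true  false false _ = inj₁ (refl , refl)
code-≡ true  true  true  true  _ = inj₁ (refl , refl)
code-≡ false true  false true  _ = inj₂ (refl , refl)
code-≡ true  false true  false _ = inj₂ (refl , refl)
code-≡ false false false true  ()
code-≡ false false true  false ()
code-≡ false true  false false ()
code-≡ false true  true  false ()
code-≡ false true  true  true  ()
code-≡ true  false false false ()
code-≡ true  false false true  ()
code-≡ true  false true  true  ()
code-≡ true  true  false true  ()
code-≡ true  true  true  false ()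

ternaryThueMorse : ℕ → Fin 3
ternaryThueMorse i = code (thueMorse i) (thueMorse (suc i))

module _ (i m : ℕ) (sq : SquareAt ternaryThueMorse i m) where

  private
    next : ∀ a j → thueMorse (suc (a + j)) ≡ thueMorse (a + suc j)
    next a j = cong thueMorse (sym (+-suc a j))

    at-0 : ∀ a → thueMorse (a + 0) ≡ thueMorse a
    at-0 a = cong thueMorse (+-identityʳ a)

  square-agreeing⇒overlap : thueMorse i ≡ thueMorse (i + m) → Overlap i m
  square-agreeing⇒overlap e zero _ = trans (at-0 i) (trans e (sym (at-0 (i + m))))
  square-agreeing⇒overlap e (suc j) j<m
    with code-≡ _ _ _ _ (sq j j<m) | square-agreeing⇒overlap e j (<⇒≤ j<m)
  ... | inj₁ (b≡ , d≡) | e′ = trans (sym (next i j)) (trans (sym b≡) (trans e′ (trans d≡ (next (i + m) j))))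
  ... | inj₂ (_ , b≡d) | _  = trans (sym (next i j)) (trans b≡d (next (i + m) j))

  square-disagreeing⇒constant : thueMorse i ≢ thueMorse (i + m) →
                                 ∀ j → j ≤ m →
                                 thueMorse (i + j) ≡ thueMorse i × thueMorse (i + j) ≢ thueMorse (i + m + j)
  square-disagreeing⇒constant d zero _ = at-0 i , λ e → d (trans (sym (at-0 i)) (trans e (at-0 (i + m))))
  square-disagreeing⇒constant d (suc j) j<m
    with code-≡ _ _ _ _ (sq j j<m) | square-disagreeing⇒constant d j (<⇒≤ j<m)
  ... | inj₁ (b≡ , d≡) | const , differ =
    trans (sym (next i j)) (trans (sym b≡) const) ,
    λ e → differ (trans b≡ (trans (next i j) (trans e (trans (sym (next (i + m) j)) (sym d≡)))))
  ... | inj₂ (a≡c , _) | _ , differ = contradiction a≡c differ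

ternaryThueMorse-squareFree : ∀ i m → 1 ≤ m → ¬ SquareAt ternaryThueMorse i m
ternaryThueMorse-squareFree i m 1≤m sq with thueMorse i Bool.≟ thueMorse (i + m)
... | yes agree = thueMorse-overlapFree m i 1≤m (square-agreeing⇒overlap i m sq agree)
... | no disagree = disagree (sym (proj₁ (square-disagreeing⇒constant i m sq disagree m ≤-refl)))

-- Periodic colourings with a marker

module _ (N : ℕ) .{{_ : NonZero N}} where

  %-+-small : ∀ a j → j < N → (a + j) % N ≡ (a % N + j) % N
  %-+-small a j j<N = trans (%-distribˡ-+ a j N) (cong (λ t → (a % N + t) % N) (m<n⇒m%n≡m j<N))

  %-shift-≢ : ∀ a d → 1 ≤ d → d < N → (a + d) % N ≢ a % N
  %-shift-≢ a d@(suc _) _ d<N e with a % N + d <? N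
  ... | yes fits = m+1+n≢m (a % N) (begin
    a % N + d        ≡⟨ sym (m<n⇒m%n≡m fits) ⟩
    (a % N + d) % N  ≡⟨ sym (%-+-small a d d<N) ⟩
    (a + d) % N      ≡⟨ e ⟩
    a % N            ∎)
    where open ≡-Reasoning
  ... | no wraps = <⇒≢ d<N (+-cancelˡ-≡ r d N (begin
    r + d            ≡⟨ sym (m∸n+n≡m N≤r+d) ⟩
    (r + d ∸ N) + N  ≡⟨ cong (_+ N) wrapped≡r ⟩
    r + N            ∎))
    where
    open ≡-Reasoning
    r : ℕ
    r = a % N
    N≤r+d : N ≤ r + d
    N≤r+d = ≮⇒≥ wraps
    wrapped≡r : r + d ∸ N ≡ r
    wrapped≡r = begin
      r + d ∸ N                ≡⟨ sym (m<n⇒m%n≡m (m<n+o⇒m∸n<o (r + d) N (+-mono-< (m%n<n a N) d<N))) ⟩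
      (r + d ∸ N) % N          ≡⟨ sym ([m+n]%n≡m%n (r + d ∸ N) N) ⟩
      ((r + d ∸ N) + N) % N    ≡⟨ cong (_% N) (m∸n+n≡m N≤r+d) ⟩
      (r + d) % N              ≡⟨ sym (%-+-small a d d<N) ⟩
      (a + d) % N              ≡⟨ e ⟩
      r                        ∎

module Marking (ℓ : ℕ) where

  IsMarker : ℕ → Set
  IsMarker i = i % suc ℓ ≡ ℓ

  markers-apart : ∀ a d → IsMarker a → IsMarker (a + d) → 1 ≤ d → d ≤ ℓ → ⊥
  markers-apart a d a-marked a+d-marked 1≤d d≤ℓ =
    %-shift-≢ (suc ℓ) a d 1≤d (s≤s d≤ℓ) (trans a+d-marked (sym a-marked))

  module Colouring {C : Set} (marker : C) (g : Fin 3 → C)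
                   (g-injective : ∀ {a b} → g a ≡ g b → a ≡ b) (g≢marker : ∀ y → g y ≢ marker) where

    residueColour : ℕ → C
    residueColour r with r ≟ ℓ
    ... | yes _ = marker
    ... | no _ = g (ternaryThueMorse r)

    residueColour-other : ∀ {r} → r ≢ ℓ → residueColour r ≡ g (ternaryThueMorse r)
    residueColour-other {r} r≢ℓ with r ≟ ℓ
    ... | yes r≡ℓ = contradiction r≡ℓ r≢ℓ
    ... | no _ = refl

    periodic : ℕ → C
    periodic i = residueColour (i % suc ℓ)

    periodic-marker : ∀ i → IsMarker i → periodic i ≡ marker
    periodic-marker i marked with i % suc ℓ ≟ ℓ
    ... | yes _ = refl
    ... | no unmarked = contradiction marked unmarked

    periodic≡marker : ∀ i → periodic i ≡ marker → IsMarker i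
    periodic≡marker i e with i % suc ℓ ≟ ℓ
    ... | yes marked = marked
    ... | no _ = contradiction e (g≢marker _)

    private
      marker-partner : ∀ a m → IsMarker a → periodic a ≡ periodic (a + m) → 1 ≤ m → m ≤ ℓ → ⊥
      marker-partner a m marked same 1≤m m≤ℓ =
        markers-apart a m marked (periodic≡marker (a + m) (trans (sym same) (periodic-marker a marked))) 1≤m m≤ℓ

      square-meets-marker : ∀ p m → SquareAt periodic p m →
                            ∀ d → d < m + m → IsMarker (p + d) → 1 ≤ m → m ≤ ℓ → ⊥
      square-meets-marker p m sq d d<2m marked 1≤m m≤ℓ with d <? m
      ... | yes d<m = marker-partner (p + d) m marked (trans (sq d d<m) (cong periodic (+-right-comm p m d))) 1≤m m≤ℓ
      ... | no d≮m = marker-partner (p + j) m (periodic≡marker (p + j) (trans same (periodic-marker (p + d) marked)))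
                       (trans (sq j j<m) (cong periodic (+-right-comm p m j))) 1≤m m≤ℓ
        where
        j : ℕ
        j = d ∸ m
        m+j≡d : m + j ≡ d
        m+j≡d = m+[n∸m]≡n (≮⇒≥ d≮m)
        j<m : j < m
        j<m = +-cancelˡ-< m j m (subst (_< m + m) (sym m+j≡d) d<2m)
        same : periodic (p + j) ≡ periodic (p + d)
        same = trans (sq j j<m) (cong periodic (trans (+-assoc p m j) (cong (p +_) m+j≡d)))

    -- A short square either lies strictly before the marker, where the colouring
    -- is an injective image of the square-free ternary sequence, or meets the marker
    -- at some position whose partner at distance m would have to be a marker too.
    periodic-shortSquareFree : ShortSquareFree periodic (suc ℓ)
    periodic-shortSquareFree p m 1≤m 2m≤N sq with p % suc ℓ + (m + m) ≤? ℓ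
    ... | yes before = ternaryThueMorse-squareFree r m 1≤m λ j j<m → g-injective (begin
      g (ternaryThueMorse (r + j))        ≡⟨ sym (inside j (≤-trans j<m (m≤m+n m m))) ⟩
      periodic (p + j)                    ≡⟨ sq j j<m ⟩
      periodic (p + m + j)                ≡⟨ cong periodic (+-assoc p m j) ⟩
      periodic (p + (m + j))              ≡⟨ inside (m + j) (+-monoʳ-< m j<m) ⟩
      g (ternaryThueMorse (r + (m + j)))  ≡⟨ cong (g ∘ ternaryThueMorse) (sym (+-assoc r m j)) ⟩
      g (ternaryThueMorse (r + m + j))    ∎)
      where
      open ≡-Reasoning
      r : ℕ
      r = p % suc ℓ
      inside : ∀ j → j < m + m → periodic (p + j) ≡ g (ternaryThueMorse (r + j))
      inside j j<2m = trans (cong residueColour residue) (residueColour-other (<⇒≢ r+j<ℓ))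
        where
        r+j<ℓ : r + j < ℓ
        r+j<ℓ = ≤-trans (+-monoʳ-< r j<2m) before
        residue : (p + j) % suc ℓ ≡ r + j
        residue = trans (%-+-small (suc ℓ) p j (≤-trans j<2m (≤-trans (m≤n+m (m + m) r) (≤-trans before (n≤1+n ℓ)))))
                        (m<n⇒m%n≡m (≤-trans r+j<ℓ (n≤1+n ℓ)))
    ... | no crosses = square-meets-marker p m sq (ℓ ∸ r) d<2m (marker-at-distance p) 1≤m m≤ℓ
      where
      r : ℕ
      r = p % suc ℓ
      r+d≡ℓ : r + (ℓ ∸ r) ≡ ℓ
      r+d≡ℓ = m+[n∸m]≡n (s≤s⁻¹ (m%n<n p (suc ℓ)))
      d<2m : ℓ ∸ r < m + m
      d<2m = +-cancelˡ-< r (ℓ ∸ r) (m + m) (subst (_< r + (m + m)) (sym r+d≡ℓ) (≰⇒> crosses))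
      m≤ℓ : m ≤ ℓ
      m≤ℓ = s≤s⁻¹ (≤-trans (m<m+n m 1≤m) 2m≤N)
      marker-at-distance : ∀ p → IsMarker (p + (ℓ ∸ p % suc ℓ))
      marker-at-distance p = trans (%-+-small (suc ℓ) p (ℓ ∸ p % suc ℓ) (s≤s (m∸n≤m ℓ (p % suc ℓ))))
                               (trans (cong (_% suc ℓ) (m+[n∸m]≡n (s≤s⁻¹ (m%n<n p (suc ℓ))))) (m<n⇒m%n≡m ≤-refl))

module _ {A : Set} (V E : ℕ → A) where

  interleave : ℕ → A
  interleave n with halve n
  ... | k , false = V k
  ... | k , true = E k

  interleave-even : ∀ {n} k → n ≡ k + k → interleave n ≡ V k
  interleave-even k refl rewrite halve-even k = refl

  interleave-odd : ∀ {n} k → n ≡ suc (k + k) → interleave n ≡ E k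
  interleave-odd k refl rewrite halve-odd k = refl

interleave-≗ : {A : Set} {V V′ E E′ : ℕ → A} → (∀ i → V i ≡ V′ i) → (∀ i → E i ≡ E′ i) →
               ∀ n → interleave V E n ≡ interleave V′ E′ n
interleave-≗ V≗V′ E≗E′ n with halve n
... | k , false = V≗V′ k
... | k , true = E≗E′ k

module InterleavedSquares {A : Set} (V E : ℕ → A) (N : ℕ) (Marked : ℕ → Set)
  (marks-apart : ∀ a d → Marked a → Marked (a + d) → 1 ≤ d → d < N → ⊥)
  (V-shortSquareFree : ShortSquareFree V N)
  (V≢E : ∀ i → V i ≢ E i) (E≢V : ∀ i → E i ≢ V (suc i))
  (V≡E⇒marked : ∀ a b → V a ≡ E b → Marked a ⊎ Marked b) where

  T : ℕ → A
  T = interleave V E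

  private
    square-at : ∀ p m → SquareAt T p m → ∀ j → j < m → ∀ {a b} → p + j ≡ a → p + m + j ≡ b → T a ≡ T b
    square-at p m sq j j<m refl refl = sq j j<m

  even-period : ∀ p k → 1 ≤ k → k + k < N → ¬ SquareAt T p (k + k)
  even-period p k 1≤k 2k<N sq with parity p
  ... | i , inj₁ refl = V-shortSquareFree i k 1≤k (<⇒≤ 2k<N) λ j j<k → begin
    V (i + j)      ≡⟨ sym (interleave-even V E (i + j) refl) ⟩
    T ((i + j) + (i + j)) ≡⟨ square-at (i + i) (k + k) sq (j + j) (+-mono-< j<k j<k) (start i j) (end i k j) ⟩
    T ((i + k + j) + (i + k + j)) ≡⟨ interleave-even V E (i + k + j) refl ⟩
    V (i + k + j)  ∎
    where
    open ≡-Reasoning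
    start : ∀ i j → i + i + (j + j) ≡ (i + j) + (i + j)
    start = solve-∀
    end : ∀ i k j → i + i + (k + k) + (j + j) ≡ (i + k + j) + (i + k + j)
    end = solve-∀
  ... | i , inj₂ refl = V-shortSquareFree (suc i) k 1≤k (<⇒≤ 2k<N) λ j j<k → begin
    V (suc i + j)      ≡⟨ sym (interleave-even V E (suc i + j) refl) ⟩
    T ((suc i + j) + (suc i + j))
      ≡⟨ square-at (suc (i + i)) (k + k) sq (suc (j + j)) (subst (_≤ k + k) (sym (double-suc j)) (+-mono-≤ j<k j<k))
                   (start i j) (end i k j) ⟩
    T ((suc i + k + j) + (suc i + k + j)) ≡⟨ interleave-even V E (suc i + k + j) refl ⟩
    V (suc i + k + j)  ∎
    where
    open ≡-Reasoning
    start : ∀ i j → suc (i + i) + suc (j + j) ≡ (suc i + j) + (suc i + j)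
    start = solve-∀
    end : ∀ i k j → suc (i + i) + (k + k) + suc (j + j) ≡ (suc i + k + j) + (suc i + k + j)
    end = solve-∀

  private
    even+odd : ∀ a b → a + a + suc (b + b) ≡ suc ((a + b) + (a + b))
    even+odd = solve-∀

    odd+odd : ∀ a b → suc (a + a) + suc (b + b) ≡ suc (a + b) + suc (a + b)
    odd+odd = solve-∀

    apart : ∀ {a b} d → a + d ≡ b → Marked a → Marked b → 1 ≤ d → d < N → ⊥
    apart {a} d refl = marks-apart a d

    square-at′ : ∀ p m → SquareAt T p m → ∀ j → j < m → T (j + p) ≡ T (j + (p + m))
    square-at′ p m sq j j<m = begin
      T (j + p)        ≡⟨ cong T (+-comm j p) ⟩
      T (p + j)        ≡⟨ sq j j<m ⟩
      T (p + m + j)    ≡⟨ cong T (+-comm (p + m) j) ⟩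
      T (j + (p + m))  ∎
      where open ≡-Reasoning

    T-even : ∀ {n} k → n ≡ k + k → T n ≡ V k
    T-even = interleave-even V E

    T-odd : ∀ {n} k → n ≡ suc (k + k) → T n ≡ E k
    T-odd = interleave-odd V E

    even≡odd⇒marked : ∀ {n n′} a b → T n ≡ T n′ → n ≡ a + a → n′ ≡ suc (b + b) → Marked a ⊎ Marked b
    even≡odd⇒marked a b e n≡ n′≡ = V≡E⇒marked a b (trans (sym (T-even a n≡)) (trans e (T-odd b n′≡)))

    odd≡even⇒marked : ∀ {n n′} a b → T n ≡ T n′ → n ≡ suc (a + a) → n′ ≡ b + b → Marked a ⊎ Marked b
    odd≡even⇒marked a b e n≡ n′≡ with V≡E⇒marked b a (trans (sym (T-even b n′≡)) (trans (sym e) (T-odd a n≡)))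
    ... | inj₁ b-marked = inj₂ b-marked
    ... | inj₂ a-marked = inj₁ a-marked

    module OddPeriodBounds (K : ℕ) (1≤K : 1 ≤ K) (m<N : suc (K + K) < N) where
      0<m : 0 < suc (K + K)
      0<m = s≤s z≤n
      1<m : 1 < suc (K + K)
      1<m = s≤s (≤-trans 1≤K (m≤m+n K K))
      2<m : 2 < suc (K + K)
      2<m = s≤s (+-mono-≤ 1≤K 1≤K)
      K<N : K < N
      K<N = <-trans (s≤s (m≤m+n K K)) m<N
      sK<N : suc K < N
      sK<N = ≤-trans (s≤s (subst (_≤ K + K) (+-comm K 1) (+-monoʳ-≤ K 1≤K))) (<⇒≤ m<N)
      1<N : 1 < N
      1<N = ≤-trans (s≤s (s≤s z≤n)) sK<N

  period-one : ∀ p → ¬ SquareAt T p 1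
  period-one p sq with parity p | square-at′ p 1 sq 0 (s≤s z≤n)
  ... | i , inj₁ refl | e = V≢E i (trans (sym (T-even i refl)) (trans e (T-odd i (+-comm (i + i) 1))))
  ... | i , inj₂ refl | e =
    E≢V i (trans (sym (T-odd i refl)) (trans e (T-even (suc i) (trans (+-comm (suc (i + i)) 1) (double-suc i)))))

  -- An odd period pairs vertex entries with edge entries, so each of the first three
  -- positions forces a marker at one of two indices less than N apart.
  odd-period : ∀ p K → 1 ≤ K → suc (K + K) < N → ¬ SquareAt T p (suc (K + K))
  odd-period p K 1≤K m<N sq with parity p
  ... | i , inj₁ refl = marks
    (even≡odd⇒marked i (i + K) (at 0 0<m) refl (even+odd i K))
    (odd≡even⇒marked i (suc (i + K)) (at 1 1<m) refl (trans (cong suc (even+odd i K)) (double-suc (i + K))))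
    (even≡odd⇒marked (suc i) (suc (i + K)) (at 2 2<m) (double-suc i)
                     (cong suc (trans (cong suc (even+odd i K)) (double-suc (i + K)))))
    where
    at : ∀ j → j < suc (K + K) → T (j + (i + i)) ≡ T (j + (i + i + suc (K + K)))
    open OddPeriodBounds K 1≤K m<N
    at = square-at′ (i + i) (suc (K + K)) sq
    marks : Marked i ⊎ Marked (i + K) → Marked i ⊎ Marked (suc (i + K)) → Marked (suc i) ⊎ Marked (suc (i + K)) → ⊥
    marks (inj₁ mi) _ (inj₁ msi) = apart 1 (+-comm i 1) mi msi (s≤s z≤n) 1<N
    marks (inj₁ mi) _ (inj₂ msiK) = apart (suc K) (+-suc i K) mi msiK (s≤s z≤n) sK<N
    marks (inj₂ miK) (inj₁ mi) _ = apart K refl mi miK 1≤K K<N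
    marks (inj₂ miK) (inj₂ msiK) _ = apart 1 (+-comm (i + K) 1) miK msiK (s≤s z≤n) 1<N
  ... | i , inj₂ refl = marks
    (odd≡even⇒marked i (suc (i + K)) (at 0 0<m) refl (odd+odd i K))
    (even≡odd⇒marked (suc i) (suc (i + K)) (at 1 1<m) (double-suc i) (cong suc (odd+odd i K)))
    (odd≡even⇒marked (suc i) (suc (suc (i + K))) (at 2 2<m) (cong suc (double-suc i))
         (trans (cong (λ n → suc (suc n)) (odd+odd i K)) (double-suc (suc (i + K)))))
    where
    at : ∀ j → j < suc (K + K) → T (j + suc (i + i)) ≡ T (j + (suc (i + i) + suc (K + K)))
    open OddPeriodBounds K 1≤K m<N
    at = square-at′ (suc (i + i)) (suc (K + K)) sq
    marks : Marked i ⊎ Marked (suc (i + K)) → Marked (suc i) ⊎ Marked (suc (i + K)) →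
            Marked (suc i) ⊎ Marked (suc (suc (i + K))) → ⊥
    marks (inj₁ mi) (inj₁ msi) _ = apart 1 (+-comm i 1) mi msi (s≤s z≤n) 1<N
    marks (inj₁ mi) (inj₂ msiK) _ = apart (suc K) (+-suc i K) mi msiK (s≤s z≤n) sK<N
    marks (inj₂ msiK) _ (inj₁ msi) = apart K refl msi msiK 1≤K K<N
    marks (inj₂ msiK) _ (inj₂ mssiK) = apart 1 (+-comm (suc (i + K)) 1) msiK mssiK (s≤s z≤n) 1<N

  interleave-squareFree : ∀ p m → 1 ≤ m → m < N → ¬ SquareAt T p m
  interleave-squareFree p m 1≤m m<N with parity m
  ... | zero , inj₁ refl = contradiction 1≤m λ ()
  ... | suc k , inj₁ refl = even-period p (suc k) (s≤s z≤n) m<N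
  ... | zero , inj₂ refl = period-one p
  ... | suc K , inj₂ refl = odd-period p (suc K) (s≤s z≤n) m<N

reverse-∷-∷ : {A : Set} (u w : A) (rest : List A) → reverse (u ∷ w ∷ rest) ≡ reverse rest ++ w ∷ u ∷ []
reverse-∷-∷ u w rest = begin
  reverse (u ∷ w ∷ rest)        ≡⟨ unfold-reverse u (w ∷ rest) ⟩
  reverse (w ∷ rest) ∷ʳ u       ≡⟨ cong (_∷ʳ u) (unfold-reverse w rest) ⟩
  (reverse rest ∷ʳ w) ∷ʳ u      ≡⟨ ++-assoc (reverse rest) (w ∷ []) (u ∷ []) ⟩
  reverse rest ++ w ∷ u ∷ []    ∎
  where open ≡-Reasoning

module _ {G : Graph} {C : Set} (φ : TotalColouring G C) where

  ThueSequences : List (Fin (size G)) → Set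
  ThueSequences vs = Nonrepetitive (totalSeq φ vs) × Nonrepetitive (vertexSeq φ vs) × Nonrepetitive (edgeSeq φ vs)

  module _ (F : ℕ → Fin (size G)) where

    vertexSeq-window : ∀ s L → vertexSeq φ (window F s L) ≡ window (vertexCol φ ∘ F) s L
    vertexSeq-window s zero = refl
    vertexSeq-window s (suc L) = cong (vertexCol φ (F s) ∷_) (vertexSeq-window (suc s) L)

    stepCol : ℕ → C
    stepCol i = edgeCol φ (F i) (F (suc i))

    edgeSeq-window : ∀ s k → edgeSeq φ (window F s (suc k)) ≡ window stepCol s k
    edgeSeq-window s zero = refl
    edgeSeq-window s (suc k) = cong (stepCol s ∷_) (edgeSeq-window (suc s) k)

    totalSeq-window : ∀ s k → totalSeq φ (window F s (suc k)) ≡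
                              window (interleave (vertexCol φ ∘ F) stepCol) (s + s) (suc (k + k))
    totalSeq-window s zero = cong (_∷ []) (sym (interleave-even (vertexCol φ ∘ F) stepCol s refl))
    totalSeq-window s (suc k) = begin
      totalSeq φ (window F s (suc (suc k)))
        ≡⟨ cong (λ t → vertexCol φ (F s) ∷ stepCol s ∷ t) (totalSeq-window (suc s) k) ⟩
      vertexCol φ (F s) ∷ stepCol s ∷ window T (suc s + suc s) (suc (k + k))
        ≡⟨ cong₂ _∷_ (sym (interleave-even (vertexCol φ ∘ F) stepCol s refl))
             (cong₂ _∷_ (sym (interleave-odd (vertexCol φ ∘ F) stepCol s refl))
               (cong₂ (window T) (sym (double-suc s)) (sym (+-suc k k)))) ⟩
      window T (s + s) (suc (suc k + suc k))                              ∎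
      where
      open ≡-Reasoning
      T : ℕ → C
      T = interleave (vertexCol φ ∘ F) stepCol

  edgeSeq-snoc : ∀ ws w u → edgeSeq φ (ws ++ w ∷ u ∷ []) ≡ edgeSeq φ (ws ∷ʳ w) ∷ʳ edgeCol φ w u
  edgeSeq-snoc [] w u = refl
  edgeSeq-snoc (a ∷ []) w u = refl
  edgeSeq-snoc (a ∷ b ∷ ws) w u = cong (edgeCol φ a b ∷_) (edgeSeq-snoc (b ∷ ws) w u)

  totalSeq-snoc : ∀ ws w u →
                  totalSeq φ (ws ++ w ∷ u ∷ []) ≡ totalSeq φ (ws ∷ʳ w) ++ edgeCol φ w u ∷ vertexCol φ u ∷ []
  totalSeq-snoc [] w u = refl
  totalSeq-snoc (a ∷ []) w u = refl
  totalSeq-snoc (a ∷ b ∷ ws) w u = cong (λ t → vertexCol φ a ∷ edgeCol φ a b ∷ t) (totalSeq-snoc (b ∷ ws) w u)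

  edgeSeq-reverse : ∀ {vs} → Linked (Adj G) vs → edgeSeq φ (reverse vs) ≡ reverse (edgeSeq φ vs)
  edgeSeq-reverse [] = refl
  edgeSeq-reverse [-] = refl
  edgeSeq-reverse {u ∷ w ∷ rest} (adj ∷ linked) = begin
    edgeSeq φ (reverse (u ∷ w ∷ rest))                 ≡⟨ cong (edgeSeq φ) (reverse-∷-∷ u w rest) ⟩
    edgeSeq φ (reverse rest ++ w ∷ u ∷ [])             ≡⟨ edgeSeq-snoc (reverse rest) w u ⟩
    edgeSeq φ (reverse rest ∷ʳ w) ∷ʳ edgeCol φ w u
      ≡⟨ cong₂ _∷ʳ_ (cong (edgeSeq φ) (sym (unfold-reverse w rest))) (sym (edgeSym φ u w adj)) ⟩
    edgeSeq φ (reverse (w ∷ rest)) ∷ʳ edgeCol φ u w    ≡⟨ cong (_∷ʳ edgeCol φ u w) (edgeSeq-reverse linked) ⟩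
    reverse (edgeSeq φ (w ∷ rest)) ∷ʳ edgeCol φ u w    ≡⟨ unfold-reverse (edgeCol φ u w) (edgeSeq φ (w ∷ rest)) ⟨
    reverse (edgeSeq φ (u ∷ w ∷ rest))                 ∎
    where open ≡-Reasoning

  totalSeq-reverse : ∀ {vs} → Linked (Adj G) vs → totalSeq φ (reverse vs) ≡ reverse (totalSeq φ vs)
  totalSeq-reverse [] = refl
  totalSeq-reverse [-] = refl
  totalSeq-reverse {u ∷ w ∷ rest} (adj ∷ linked) = begin
    totalSeq φ (reverse (u ∷ w ∷ rest))                           ≡⟨ cong (totalSeq φ) (reverse-∷-∷ u w rest) ⟩
    totalSeq φ (reverse rest ++ w ∷ u ∷ [])                       ≡⟨ totalSeq-snoc (reverse rest) w u ⟩
    totalSeq φ (reverse rest ∷ʳ w) ++ edgeCol φ w u ∷ vertexCol φ u ∷ []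
      ≡⟨ cong₂ (λ t e → t ++ e ∷ vertexCol φ u ∷ [])
               (cong (totalSeq φ) (sym (unfold-reverse w rest))) (sym (edgeSym φ u w adj)) ⟩
    totalSeq φ (reverse (w ∷ rest)) ++ edgeCol φ u w ∷ vertexCol φ u ∷ []
      ≡⟨ cong (_++ edgeCol φ u w ∷ vertexCol φ u ∷ []) (totalSeq-reverse linked) ⟩
    reverse (totalSeq φ (w ∷ rest)) ++ edgeCol φ u w ∷ vertexCol φ u ∷ []
      ≡⟨ sym (reverse-∷-∷ (vertexCol φ u) (edgeCol φ u w) (totalSeq φ (w ∷ rest))) ⟩
    reverse (totalSeq φ (u ∷ w ∷ rest))                           ∎
    where open ≡-Reasoning

  thueSequences-reverse : ∀ {vs} → Linked (Adj G) vs → ThueSequences (reverse vs) → ThueSequences vs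
  thueSequences-reverse {vs} linked (total , vertex , edge) =
    transport (totalSeq φ vs) (totalSeq-reverse linked) total ,
    transport (vertexSeq φ vs) (reverse-map (vertexCol φ) vs) vertex ,
    transport (edgeSeq φ vs) (edgeSeq-reverse linked) edge
    where
    transport : ∀ (l : List C) {seq} → seq ≡ reverse l → Nonrepetitive seq → Nonrepetitive l
    transport l {seq} e nr =
      subst Nonrepetitive (reverse-involutive l) (subst (Nonrepetitive ∘ reverse) e (nonrepetitive-reverse seq nr))

-- Paths in a cycle

module CycleGeometry (ℓ : ℕ) (h : 3 ≤ suc ℓ) where

  position : ℕ → Fin (suc ℓ)
  position i = fromℕ< (m%n<n i (suc ℓ))

  toℕ-position : ∀ i → toℕ (position i) ≡ i % suc ℓ
  toℕ-position i = toℕ-fromℕ< (m%n<n i (suc ℓ))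

  position-toℕ : ∀ u → position (toℕ u) ≡ u
  position-toℕ u = toℕ-injective (trans (toℕ-position (toℕ u)) (m<n⇒m%n≡m (toℕ<n u)))

  position-≡ : ∀ a b → a % suc ℓ ≡ b % suc ℓ → position a ≡ position b
  position-≡ a b e = toℕ-injective (trans (toℕ-position a) (trans e (sym (toℕ-position b))))

  position-≡⁻¹ : ∀ a b → position a ≡ position b → a % suc ℓ ≡ b % suc ℓ
  position-≡⁻¹ a b e = trans (sym (toℕ-position a)) (trans (cong toℕ e) (toℕ-position b))

  position-+ : ∀ a b j → position a ≡ position b → position (a + j) ≡ position (b + j)
  position-+ a b j e = position-≡ (a + j) (b + j) (begin
    (a + j) % suc ℓ                      ≡⟨ %-distribˡ-+ a j (suc ℓ) ⟩
    (a % suc ℓ + j % suc ℓ) % suc ℓ      ≡⟨ cong (λ t → (t + j % suc ℓ) % suc ℓ) (position-≡⁻¹ a b e) ⟩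
    (b % suc ℓ + j % suc ℓ) % suc ℓ      ≡⟨ %-distribˡ-+ b j (suc ℓ) ⟨
    (b + j) % suc ℓ                      ∎)
    where open ≡-Reasoning

  position-suc : ∀ a b → position a ≡ position b → position (suc a) ≡ position (suc b)
  position-suc a b e = trans (cong position (+-comm 1 a)) (trans (position-+ a b 1 e) (cong position (+-comm b 1)))

  position-shift-≢ : ∀ a d → 1 ≤ d → d ≤ ℓ → position (a + d) ≢ position a
  position-shift-≢ a d 1≤d d≤ℓ e = %-shift-≢ (suc ℓ) a d 1≤d (s≤s d≤ℓ) (position-≡⁻¹ (a + d) a e)

  position-period : ∀ a → position (a + suc ℓ) ≡ position a
  position-period a = position-≡ (a + suc ℓ) a ([m+n]%n≡m%n a (suc ℓ))

  position-suc-injective : ∀ a b → position (suc a) ≡ position (suc b) → position a ≡ position b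
  position-suc-injective a b e = begin
    position a                  ≡⟨ position-period a ⟨
    position (a + suc ℓ)        ≡⟨ cong position (+-suc a ℓ) ⟩
    position (suc a + ℓ)        ≡⟨ position-+ (suc a) (suc b) ℓ e ⟩
    position (suc b + ℓ)        ≡⟨ cong position (+-suc b ℓ) ⟨
    position (b + suc ℓ)        ≡⟨ position-period b ⟩
    position b                  ∎
    where open ≡-Reasoning

  window-position-cong : ∀ a b L → position a ≡ position b → window position a L ≡ window position b L
  window-position-cong a b zero e = refl
  window-position-cong a b (suc L) e = cong₂ _∷_ e (window-position-cong (suc a) (suc b) L (position-suc a b e))

  step-position : ∀ {u w} → CycleStep (suc ℓ) u w → w ≡ position (suc (toℕ u))
  step-position {u} {w} s = toℕ-injective (sym (trans (toℕ-position (suc (toℕ u))) (step-% s)))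
    where
    step-% : CycleStep (suc ℓ) u w → suc (toℕ u) % suc ℓ ≡ toℕ w
    step-% (inj₁ e) = trans (cong (_% suc ℓ) (sym e)) (m<n⇒m%n≡m (toℕ<n w))
    step-% (inj₂ (e₁ , e₂)) = trans (cong (_% suc ℓ) e₁) (trans (n%n≡0 (suc ℓ)) (sym e₂))

  adjacent-position : ∀ {u w} → CycleAdj (suc ℓ) u w → w ≡ position (suc (toℕ u)) ⊎ u ≡ position (suc (toℕ w))
  adjacent-position (inj₁ s) = inj₁ (step-position s)
  adjacent-position (inj₂ s) = inj₂ (step-position s)

  Arc : List (Fin (suc ℓ)) → Set
  Arc vs = ∃[ a ] ∃[ L ] (vs ≡ window position a L ⊎ vs ≡ reverse (window position a L))

  position-suc-toℕ : ∀ a → position (suc (toℕ (position a))) ≡ position (suc a)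
  position-suc-toℕ a = position-suc (toℕ (position a)) a (position-toℕ (position a))

  edge-arc : ∀ u w → CycleAdj (suc ℓ) u w → Arc (u ∷ w ∷ [])
  edge-arc u w adj with adjacent-position adj
  ... | inj₁ forward = toℕ u , 2 , inj₁ (cong₂ (λ x y → x ∷ y ∷ []) (sym (position-toℕ u)) forward)
  ... | inj₂ backward = toℕ w , 2 , inj₂ (cong₂ (λ x y → x ∷ y ∷ []) backward (sym (position-toℕ w)))

  -- Distinctness of u and x rules out turning back, so a path runs around the cycle in one direction.
  extend-arc : ∀ {u w x rest} → u ≢ x → CycleAdj (suc ℓ) u w → Arc (w ∷ x ∷ rest) → Arc (u ∷ w ∷ x ∷ rest)
  extend-arc _ _ (_ , zero , inj₁ ())
  extend-arc _ _ (_ , suc zero , inj₁ ())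
  extend-arc _ _ (_ , zero , inj₂ ())
  extend-arc _ _ (_ , suc zero , inj₂ ())
  extend-arc {u} {w} {x} u≢x adj (a , suc (suc L) , inj₁ eq) with adjacent-position adj
  ... | inj₁ forward = toℕ u , suc (suc (suc L)) , inj₁ (cong₂ _∷_ (sym (position-toℕ u))
          (trans eq (window-position-cong a (suc (toℕ u)) (suc (suc L)) (trans (sym (∷-injectiveˡ eq)) forward))))
  ... | inj₂ backward = contradiction (begin
    u                             ≡⟨ backward ⟩
    position (suc (toℕ w))        ≡⟨ cong (λ v → position (suc (toℕ v))) (∷-injectiveˡ eq) ⟩
    position (suc (toℕ (position a)))  ≡⟨ position-suc-toℕ a ⟩
    position (suc a)              ≡⟨ ∷-injectiveˡ (∷-injectiveʳ eq) ⟨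
    x                             ∎) u≢x
    where open ≡-Reasoning
  extend-arc {u} {w} {x} {rest} u≢x adj (a , suc (suc L) , inj₂ eq) with adjacent-position adj
  ... | inj₁ forward = contradiction (begin
    u                             ≡⟨ position-toℕ u ⟨
    position (toℕ u)              ≡⟨ position-suc-injective (toℕ u) (a + L) (begin
        position (suc (toℕ u))    ≡⟨ forward ⟨
        w                         ≡⟨ w≡ ⟩
        position (a + suc L)      ≡⟨ cong position (+-suc a L) ⟩
        position (suc (a + L))    ∎) ⟩
    position (a + L)              ≡⟨ x≡ ⟨
    x                             ∎) u≢x
    where
    open ≡-Reasoning
    descent : w ∷ x ∷ rest ≡ position (a + suc L) ∷ reverse (window position a (suc L))
    descent = trans eq (reverse-window-suc position a (suc L))
    w≡ : w ≡ position (a + suc L)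
    w≡ = ∷-injectiveˡ descent
    x≡ : x ≡ position (a + L)
    x≡ = ∷-injectiveˡ (trans (∷-injectiveʳ descent) (reverse-window-suc position a L))
  ... | inj₂ backward =
    a , suc (suc (suc L)) , inj₂ (trans (cong₂ _∷_ u≡ eq) (sym (reverse-window-suc position a (suc (suc L)))))
    where
    u≡ : u ≡ position (a + suc (suc L))
    u≡ = begin
      u                                    ≡⟨ backward ⟩
      position (suc (toℕ w))
        ≡⟨ cong (λ v → position (suc (toℕ v))) (∷-injectiveˡ (trans eq (reverse-window-suc position a (suc L)))) ⟩
      position (suc (toℕ (position (a + suc L)))) ≡⟨ position-suc-toℕ (a + suc L) ⟩
      position (suc (a + suc L))           ≡⟨ cong position (+-suc a (suc L)) ⟨
      position (a + suc (suc L))           ∎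
      where open ≡-Reasoning

  path-arc : ∀ vs → IsPath (Cycle (suc ℓ) h) vs → Arc vs
  path-arc [] _ = 0 , 0 , inj₁ refl
  path-arc (u ∷ []) _ = toℕ u , 1 , inj₁ (cong (_∷ []) (sym (position-toℕ u)))
  path-arc (u ∷ w ∷ []) (_ , adj ∷ _) = edge-arc u w adj
  path-arc (u ∷ w ∷ x ∷ rest) (((_ ∷ u≢x ∷ _) ∷ unique) , (adj ∷ linked)) =
    extend-arc u≢x adj (path-arc (w ∷ x ∷ rest) (unique , linked))

  window-unique-length : ∀ a L → Unique (window position a L) → L ≤ suc ℓ
  window-unique-length a zero _ = z≤n
  window-unique-length a (suc L) (fresh ∷ _) with L ≤? ℓ
  ... | yes L≤ℓ = s≤s L≤ℓ
  ... | no L≰ℓ =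
    contradiction (subst (_∈ window position (suc a) L) wraps (∈-window position (suc a) L ℓ (≰⇒> L≰ℓ)))
                  (All¬⇒¬Any fresh)
    where
    wraps : position (suc a + ℓ) ≡ position a
    wraps = trans (cong position (sym (+-suc a ℓ))) (position-period a)

  reverse-window-unique-length : ∀ a L → Unique (reverse (window position a L)) → L ≤ suc ℓ
  reverse-window-unique-length a zero _ = z≤n
  reverse-window-unique-length a (suc L) unique with subst Unique (reverse-window-suc position a L) unique
  ... | fresh ∷ _ with L ≤? ℓ
  ...   | yes L≤ℓ = s≤s L≤ℓ
  ...   | no L≰ℓ = contradiction (Any.reverse⁺ (subst (_∈ window position a L) wraps (∈-window position a L j j<L)))
                                   (All¬⇒¬Any fresh)
    where
    j : ℕ
    j = L ∸ suc ℓ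
    j+N≡L : j + suc ℓ ≡ L
    j+N≡L = m∸n+n≡m (≰⇒> L≰ℓ)
    j<L : j < L
    j<L = subst (j <_) j+N≡L (m<m+n j (s≤s z≤n))
    wraps : position (a + j) ≡ position (a + L)
    wraps = trans (sym (position-period (a + j))) (cong position (trans (+-assoc a j (suc ℓ)) (cong (a +_) j+N≡L)))

-- Six colours suffice

lo hi : Fin 3 → Fin 6
lo y = y ↑ˡ 3
hi y = 3 ↑ʳ y

lo≢hi : ∀ a b → lo a ≢ hi b
lo≢hi a b e =
  <⇒≢ (≤-trans (toℕ<n a) (m≤m+n 3 (toℕ b))) (trans (sym (toℕ-↑ˡ a 3)) (trans (cong toℕ e) (toℕ-↑ʳ 3 b)))

other : Fin 3 → Fin 3
other zero = suc zero
other (suc _) = zero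

other-≢ : ∀ c → other c ≢ c
other-≢ zero ()
other-≢ (suc _) ()

module SixColouring (k : ℕ) (h : 3 ≤ suc (suc (suc k))) where

  n : ℕ
  n = suc (suc (suc k))

  open CycleGeometry (suc (suc k)) h
  open Marking (suc (suc k))

  -- The vertex marker must differ from the colour of the edge entering it.
  vertexMarker : Fin 6
  vertexMarker = hi (other (ternaryThueMorse (suc k)))

  edgeMarker : Fin 6
  edgeMarker = lo zero

  module Vertices = Colouring vertexMarker lo (↑ˡ-injective 3 _ _) (λ y → lo≢hi y _)
  module Edges = Colouring edgeMarker hi (↑ʳ-injective 3 _ _) (λ y e → lo≢hi zero y (sym e))

  -- An edge takes the colour of its earlier endpoint in the cyclic order.
  edgeColour : Fin n → Fin n → Fin 6
  edgeColour u w with w Fin.≟ position (suc (toℕ u))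
  ... | yes _ = Edges.residueColour (toℕ u)
  ... | no _ = Edges.residueColour (toℕ w)

  no-turning : ∀ u w → w ≡ position (suc (toℕ u)) → u ≢ position (suc (toℕ w))
  no-turning u w forward backward = position-shift-≢ (toℕ u) 2 (s≤s z≤n) (s≤s (s≤s z≤n)) (begin
    position (toℕ u + 2)                           ≡⟨ cong position (+-comm (toℕ u) 2) ⟩
    position (suc (suc (toℕ u)))                   ≡⟨ position-suc-toℕ (suc (toℕ u)) ⟨
    position (suc (toℕ (position (suc (toℕ u)))))  ≡⟨ cong (λ v → position (suc (toℕ v))) forward ⟨
    position (suc (toℕ w))                         ≡⟨ backward ⟨
    u                                              ≡⟨ position-toℕ u ⟨
    position (toℕ u)                               ∎)
    where open ≡-Reasoning

  edgeColour-sym : ∀ u w → CycleAdj n u w → edgeColour u w ≡ edgeColour w u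
  edgeColour-sym u w adj with w Fin.≟ position (suc (toℕ u)) | u Fin.≟ position (suc (toℕ w))
  ... | yes forward | yes backward = contradiction backward (no-turning u w forward)
  ... | yes _ | no _ = refl
  ... | no _ | yes _ = refl
  ... | no forward | no backward with adjacent-position adj
  ...   | inj₁ forward′ = contradiction forward′ forward
  ...   | inj₂ backward′ = contradiction backward′ backward

  φ : TotalColouring (Cycle n h) (Fin 6)
  φ = record { vertexCol = Vertices.residueColour ∘ toℕ ; edgeCol = edgeColour ; edgeSym = edgeColour-sym }

  vertexCol-position : ∀ i → vertexCol φ (position i) ≡ Vertices.periodic i
  vertexCol-position i = cong Vertices.residueColour (toℕ-position i)

  stepCol-position : ∀ i → stepCol φ position i ≡ Edges.periodic i
  stepCol-position i with position (suc i) Fin.≟ position (suc (toℕ (position i)))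
  ... | yes _ = cong Edges.residueColour (toℕ-position i)
  ... | no ne = contradiction (sym (position-suc-toℕ i)) ne

  private
    suc-residue : ∀ i → suc i % n ≡ suc (i % n) % n
    suc-residue i = begin
      suc i % n                ≡⟨ cong (_% n) (+-comm 1 i) ⟩
      (i + 1) % n              ≡⟨ %-+-small n i 1 (s≤s (s≤s z≤n)) ⟩
      (i % n + 1) % n          ≡⟨ cong (_% n) (+-comm (i % n) 1) ⟩
      suc (i % n) % n          ∎
      where
      open ≡-Reasoning

  vertex≢edge : ∀ i → Vertices.periodic i ≢ Edges.periodic i
  vertex≢edge i with i % n ≟ suc (suc k)
  ... | yes _ = λ e → lo≢hi zero _ (sym e)
  ... | no _ = lo≢hi _ _

  vertex≡edge⇒marked : ∀ a b → Vertices.periodic a ≡ Edges.periodic b → IsMarker a ⊎ IsMarker b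
  vertex≡edge⇒marked a b e with a % n ≟ suc (suc k) | b % n ≟ suc (suc k)
  ... | yes a-marked | _ = inj₁ a-marked
  ... | no _ | yes b-marked = inj₂ b-marked
  ... | no _ | no _ = contradiction e (lo≢hi _ _)

  -- The edge leaving the marker meets vertex 0, coloured lo 2, and the edge entering it
  -- meets the vertex marker, which avoids that edge's colour.
  edge≢next-vertex : ∀ i → Edges.periodic i ≢ Vertices.periodic (suc i)
  edge≢next-vertex i with i % n ≟ suc (suc k)
  ... | yes marked = λ e → edgeMarker≢lo2 (trans e (cong Vertices.residueColour after-marker))
    where
    after-marker : suc i % n ≡ 0
    after-marker = trans (suc-residue i) (trans (cong (λ r → suc r % n) marked) (n%n≡0 n))
    edgeMarker≢lo2 : edgeMarker ≢ Vertices.residueColour 0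
    edgeMarker≢lo2 ()
  ... | no unmarked with i % n ≟ suc k
  ...   | yes before-marker = λ e → other-≢ (ternaryThueMorse (suc k)) (sym (↑ʳ-injective 3 _ _ (begin
    hi (ternaryThueMorse (suc k))    ≡⟨ cong (hi ∘ ternaryThueMorse) before-marker ⟨
    hi (ternaryThueMorse (i % n))    ≡⟨ e ⟩
    Vertices.periodic (suc i)        ≡⟨ Vertices.periodic-marker (suc i) next-marked ⟩
    vertexMarker                     ∎)))
    where
    open ≡-Reasoning
    next-marked : IsMarker (suc i)
    next-marked = trans (suc-residue i) (trans (cong (λ r → suc r % n) before-marker) (m<n⇒m%n≡m ≤-refl))
  ...   | no not-before = λ e → lo≢hi _ _ (sym (trans e (trans (cong Vertices.residueColour next-residue)
                                                            (Vertices.residueColour-other (not-before ∘ suc-injective)))))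
    where
    next-residue : suc i % n ≡ suc (i % n)
    next-residue = trans (suc-residue i) (m<n⇒m%n≡m (s≤s (≤∧≢⇒< (s≤s⁻¹ (m%n<n i n)) unmarked)))

  open InterleavedSquares Vertices.periodic Edges.periodic n IsMarker
         (λ a d a-marked a+d-marked 1≤d d<n → markers-apart a d a-marked a+d-marked 1≤d (s≤s⁻¹ d<n))
         Vertices.periodic-shortSquareFree vertex≢edge edge≢next-vertex vertex≡edge⇒marked

  arc-thue : ∀ a L → L ≤ n → ThueSequences φ (window position a L)
  arc-thue a zero _ = nonrepetitive-[] , nonrepetitive-[] , nonrepetitive-[]
  arc-thue a (suc L) L≤n =
    subst Nonrepetitive (sym (totalSeq-window φ position a L))
          (nonrepetitive-window total (suc (L + L)) total-ssf (a + a)) ,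
    subst Nonrepetitive (sym (vertexSeq-window φ position a (suc L))) (nonrepetitive-window vertex (suc L) vertex-ssf a) ,
    subst Nonrepetitive (sym (edgeSeq-window φ position a L)) (nonrepetitive-window edge L edge-ssf a)
    where
    vertex edge total : ℕ → Fin 6
    vertex = vertexCol φ ∘ position
    edge = stepCol φ position
    total = interleave vertex edge
    vertex-ssf : ShortSquareFree vertex (suc L)
    vertex-ssf = shortSquareFree-≤ {F = vertex} L≤n
                   (shortSquareFree-≗ vertexCol-position Vertices.periodic-shortSquareFree)
    edge-ssf : ShortSquareFree edge L
    edge-ssf = shortSquareFree-≤ {F = edge} (≤-trans (n≤1+n L) L≤n)
                 (shortSquareFree-≗ stepCol-position Edges.periodic-shortSquareFree)
    total-ssf : ShortSquareFree total (suc (L + L))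
    total-ssf = shortSquareFree-≗ {G = T} (interleave-≗ vertexCol-position stepCol-position)
                  λ p m 1≤m 2m≤ → interleave-squareFree p m 1≤m (<-≤-trans (s≤s (m+m≤1+n+n⇒m≤n m L 2m≤)) L≤n)

  thue : IsTotalThue φ
  thue vs (unique , linked) with path-arc vs (unique , linked)
  ... | a , L , inj₁ refl = arc-thue a L (window-unique-length a L unique)
  ... | a , L , inj₂ refl = thueSequences-reverse φ linked
          (subst (ThueSequences φ) (sym (reverse-involutive (window position a L)))
                 (arc-thue a L (reverse-window-unique-length a L unique)))

cycle-totalThue-6 : ∀ n (h : 3 ≤ n) → HasTotalThue (Cycle n h) 6
cycle-totalThue-6 _ h@(s≤s (s≤s (s≤s (z≤n {k})))) = SixColouring.φ k h , SixColouring.thue k h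

-- Three colours do not suffice

-- Removing y and then z leaves a single value of Fin 3.
fin3-third : ∀ {x y z w : Fin 3} → y ≢ z → x ≢ y → x ≢ z → w ≢ y → w ≢ z → w ≡ x
fin3-third {x} {y} {z} {w} y≢z x≢y x≢z w≢y w≢z =
  punchOut-injective y≢w y≢x (punchOut-injective z′≢w′ z′≢x′ (only (punchOut z′≢w′) (punchOut z′≢x′)))
  where
  y≢x : y ≢ x
  y≢x = x≢y ∘′ sym
  y≢w : y ≢ w
  y≢w = w≢y ∘′ sym
  z′≢x′ : punchOut y≢z ≢ punchOut y≢x
  z′≢x′ e = x≢z (sym (punchOut-injective y≢z y≢x e))
  z′≢w′ : punchOut y≢z ≢ punchOut y≢w
  z′≢w′ e = w≢z (sym (punchOut-injective y≢z y≢w e))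
  only : ∀ (a b : Fin 1) → a ≡ b
  only zero zero = refl

nonrepetitive-adjacent : ∀ {A : Set} (xs : List A) {a b : A} zs → Nonrepetitive (xs ++ a ∷ b ∷ zs) → a ≢ b
nonrepetitive-adjacent xs zs nr refl = nr (xs , _ ∷ [] , zs , (λ ()) , refl)

-- Over three colours, entries at distance one and two being distinct forces period three.
three-colours-square : ∀ {a b c d e f g : Fin 3} →
  a ≢ b → b ≢ c → c ≢ d → d ≢ e → e ≢ f → f ≢ g → a ≢ c → c ≢ e → e ≢ g → b ≢ d → d ≢ f →
  ¬ Nonrepetitive (a ∷ b ∷ c ∷ d ∷ e ∷ f ∷ g ∷ [])
three-colours-square ab bc cd de ef fg ac ce eg bd df
  with refl ← fin3-third bc ab ac (≢-sym bd) (≢-sym cd)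
  with refl ← fin3-third cd bc bd (≢-sym ce) (≢-sym de)
  with refl ← fin3-third de cd ce (≢-sym df) (≢-sym ef)
  with refl ← fin3-third ef de df (≢-sym eg) (≢-sym fg) =
  λ nr → nr ([] , _ ∷ _ ∷ _ ∷ [] , _ ∷ [] , (λ ()) , refl)

path4-¬totalThue3 : ∀ {G : Graph} {v₀ v₁ v₂ v₃} →
                    IsPath G (v₀ ∷ v₁ ∷ v₂ ∷ v₃ ∷ []) → ¬ HasTotalThue G 3
path4-¬totalThue3 path (ψ , thue) with total , vertex , edge ← thue _ path =
  three-colours-square
    (nonrepetitive-adjacent [] _ total)
    (nonrepetitive-adjacent (_ ∷ []) _ total)
    (nonrepetitive-adjacent (_ ∷ _ ∷ []) _ total)
    (nonrepetitive-adjacent (_ ∷ _ ∷ _ ∷ []) _ total)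
    (nonrepetitive-adjacent (_ ∷ _ ∷ _ ∷ _ ∷ []) _ total)
    (nonrepetitive-adjacent (_ ∷ _ ∷ _ ∷ _ ∷ _ ∷ []) _ total)
    (nonrepetitive-adjacent [] _ vertex)
    (nonrepetitive-adjacent (_ ∷ []) _ vertex)
    (nonrepetitive-adjacent (_ ∷ _ ∷ []) _ vertex)
    (nonrepetitive-adjacent [] _ edge)
    (nonrepetitive-adjacent (_ ∷ []) _ edge)
    total

cycle-path4 : ∀ k (h : 3 ≤ suc (suc (suc (suc k)))) →
              IsPath (Cycle (suc (suc (suc (suc k)))) h) (zero ∷ suc zero ∷ suc (suc zero) ∷ suc (suc (suc zero)) ∷ [])
cycle-path4 k h =
  ((λ ()) ∷ (λ ()) ∷ (λ ()) ∷ []) ∷ ((λ ()) ∷ (λ ()) ∷ []) ∷ ((λ ()) ∷ []) ∷ [] ∷ [] ,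
  inj₁ (inj₁ refl) ∷ inj₁ (inj₁ refl) ∷ inj₁ (inj₁ refl) ∷ [-]

corollary16 : (n : ℕ) (h : 4 ≤ n) →
    ¬ HasTotalThue (Cycle n (≤-trans (n≤1+n 3) h)) 3 × HasTotalThue (Cycle n (≤-trans (n≤1+n 3) h)) 6
corollary16 n h@(s≤s (s≤s (s≤s (s≤s (z≤n {k}))))) =
  path4-¬totalThue3 (cycle-path4 k (≤-trans (n≤1+n 3) h)) , cycle-totalThue-6 n (≤-trans (n≤1+n 3) h)
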